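{- Let $G,G'$ be finite simple graphs and $\varphi:G\to G'$ a graph homomorphism, and let $k=\max_{v\in V(G')}|\varphi^{ -1}(v)|$. Then $\mathrm{Hun}(G)\le k\,\mathrm{Hun}(G')$. In particular, if $H$ is a subgraph of $G$, then $\mathrm{Hun}(H)\le\mathrm{Hun}(G)$.
   Context: Hunters and Rabbits game on a finite simple graph $G$: a hunter strategy is a finite sequence $H=(H_1,\dots,H_m)$ of multisets of vertices. For $S\subseteq V(G)$ let $N(S)$ be the set of vertices adjacent to some vertex of $S$. Set $R_H(0)=V(G)$, $R_H(i)=N(R_H(i-1)\setminus H_i)$. $H$ is winning if $R_H(i)=\emptyset$ for some $i$. $\mathrm{Hun}(G)$ is the minimum over winning strategies of $\max_i|H_i|$ (multiplicities counted). A graph homomorphism maps vertices to vertices and adjacent vertices to adjacent vertices. -}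

module Defs where

open import Data.Nat using (ℕ; _⊔_; _≤_)
open import Data.Fin using (Fin; _≟_)
open import Data.List using (List; []; _∷_; length; filter; map; foldr; allFin)
open import Data.List.Membership.Propositional using (_∈_)
open import Data.Product using (Σ; ∃; _×_)
open import Data.Empty using (⊥)
open import Data.Unit using (⊤)
open import Relation.Nullary using (¬_)
open import Relation.Binary.PropositionalEquality using (_≡_)
open import Function.Definitions using (Injective)

record Graph : Set₁ where
  field
    n     : ℕ
    Adj   : Fin n → Fin n → Set
    sym   : ∀ {u v} → Adj u v → Adj v u
    irrefl : ∀ {u} → ¬ Adj u u

open Graph public

V : Graph → Set
V G = Fin (n G)

VSet : Graph → Set₁
VSet G = V G → Set

-- A multiset of vertices (one round of hunter shots), as a list;
-- its size with multiplicity is its length.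
Shots : Graph → Set
Shots G = List (V G)

Strategy : Graph → Set
Strategy G = List (Shots G)

step : (G : Graph) → VSet G → Shots G → VSet G
step G S H v = Σ (V G) λ u → S u × (¬ (u ∈ H)) × Adj G u v

IsEmpty : (G : Graph) → VSet G → Set
IsEmpty G S = ∀ v → ¬ S v

allV : (G : Graph) → VSet G
allV G v = ⊤

WinsFrom : (G : Graph) → VSet G → Strategy G → Set
WinsFrom G R []       = IsEmpty G R
WinsFrom G R (H ∷ Hs) = IsEmpty G R Data.Sum.⊎ WinsFrom G (step G R H) Hs
  where import Data.Sum

Winning : (G : Graph) → Strategy G → Set
Winning G Hs = WinsFrom G (allV G) Hs

width : {G : Graph} → Strategy G → ℕ
width Hs = foldr _⊔_ 0 (map length Hs)

IsHun : Graph → ℕ → Set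
IsHun G h = (Σ (Strategy G) λ Hs → Winning G Hs × width {G} Hs ≡ h)
          × (∀ Hs → Winning G Hs → h ≤ width {G} Hs)

Hom : Graph → Graph → Set
Hom G G' = Σ (V G → V G') λ φ → ∀ {u v} → Adj G u v → Adj G' (φ u) (φ v)

fibreSize : (G G' : Graph) → (V G → V G') → V G' → ℕ
fibreSize G G' φ v = length (filter (λ u → φ u ≟ v) (allFin (n G)))

maxFibre : (G G' : Graph) → (V G → V G') → ℕ
maxFibre G G' φ = foldr _⊔_ 0 (map (fibreSize G G' φ) (allFin (n G')))

-- H is a subgraph of G: (up to isomorphism) H embeds into G via an
-- injective vertex map preserving adjacency.
Subgraph : Graph → Graph → Set
Subgraph H G = Σ (Hom H G) λ φ → Injective _≡_ _≡_ (Data.Product.proj₁ φ)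
  where import Data.Product

-- Shoot, in G, the whole preimage of every vertex the hunters shoot in G'.
-- Since φ preserves adjacency, the rabbit territory in G stays inside the
-- preimage of the rabbit territory in G', so the pulled-back strategy wins
-- whenever the original does, and each round grows by a factor of at most
-- the largest fibre size k.  An embedding has k ≤ 1.
module Submission where

open import Defs hiding (sym)
open import Data.Nat using (ℕ; _≤_; _*_; _⊔_; _+_; suc; z≤n; s≤s)
open import Data.Nat.Properties
  using (≤-trans; ≤-reflexive; m≤m⊔n; m≤n⊔m; ⊔-lub; ⊔-mono-≤; +-mono-≤;
         *-zeroʳ; *-suc; *-distribˡ-⊔; *-monoˡ-≤; *-identityˡ; module ≤-Reasoning)
open import Data.Fin using (_≟_)
open import Data.List using (List; []; _∷_; length; filter; map; foldr; allFin; _++_)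
open import Data.List.Properties using (length-++; filter-none)
open import Data.List.Membership.Propositional using (_∈_)
open import Data.List.Membership.Propositional.Properties using (∈-allFin; ∈-filter⁺; ∈-++⁺ˡ; ∈-++⁺ʳ)
open import Data.List.Relation.Unary.Any using (here; there)
import Data.List.Relation.Unary.All as All
open import Data.List.Relation.Unary.Unique.Propositional using (Unique)
open import Data.List.Relation.Unary.Unique.Propositional.Properties using (allFin⁺)
open import Data.List.Relation.Unary.AllPairs using ([]; _∷_)
open import Data.Product using (_×_; _,_; proj₁; proj₂)
open import Data.Sum using (inj₁; inj₂)
open import Relation.Nullary using (yes; no)
open import Level using (0ℓ)
open import Relation.Unary using (Pred; Decidable)
open import Relation.Binary.PropositionalEquality using (_≡_; refl; sym; trans; cong)
open import Function.Definitions using (Injective)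

⊔-map-upperBound : {A : Set} (f : A → ℕ) {x : A} {xs : List A} →
                   x ∈ xs → f x ≤ foldr _⊔_ 0 (map f xs)
⊔-map-upperBound f {xs = y ∷ ys} (here refl) = m≤m⊔n (f y) _
⊔-map-upperBound f {xs = y ∷ ys} (there x∈ys) =
  ≤-trans (⊔-map-upperBound f x∈ys) (m≤n⊔m (f y) _)

⊔-map-lub : {A : Set} (f : A → ℕ) {b : ℕ} (xs : List A) →
            (∀ x → f x ≤ b) → foldr _⊔_ 0 (map f xs) ≤ b
⊔-map-lub f []       f≤b = z≤n
⊔-map-lub f (x ∷ xs) f≤b = ⊔-lub (f≤b x) (⊔-map-lub f xs f≤b)

length-filter-unique≤1 : {A : Set} {P : Pred A 0ℓ} (P? : Decidable P) →
                         (∀ {x y} → P x → P y → x ≡ y) →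
                         {xs : List A} → Unique xs → length (filter P? xs) ≤ 1
length-filter-unique≤1 P? P-unique {[]}     []            = z≤n
length-filter-unique≤1 P? P-unique {x ∷ xs} (x∉xs ∷ uniq) with P? x
... | yes Px = s≤s (≤-reflexive (cong length (filter-none P?
                 (All.map (λ x≢y Py → x≢y (P-unique Px Py)) x∉xs))))
... | no  _  = length-filter-unique≤1 P? P-unique uniq

module Pullback (G G' : Graph) (φ : Hom G G') where

  f : V G → V G'
  f = proj₁ φ

  k : ℕ
  k = maxFibre G G' f

  preimage : V G' → List (V G)
  preimage v = filter (λ u → f u ≟ v) (allFin (n G))

  pullShots : Shots G' → Shots G
  pullShots []       = []
  pullShots (v ∷ vs) = preimage v ++ pullShots vs

  pullStrategy : Strategy G' → Strategy G
  pullStrategy = map pullShots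

  ∈-pullShots : ∀ u (vs : Shots G') → f u ∈ vs → u ∈ pullShots vs
  ∈-pullShots u (v ∷ vs) (here fu≡v) =
    ∈-++⁺ˡ (∈-filter⁺ (λ u → f u ≟ v) (∈-allFin u) fu≡v)
  ∈-pullShots u (v ∷ vs) (there fu∈vs) = ∈-++⁺ʳ (preimage v) (∈-pullShots u vs fu∈vs)

  length-pullShots : ∀ vs → length (pullShots vs) ≤ k * length vs
  length-pullShots []       = ≤-reflexive (sym (*-zeroʳ k))
  length-pullShots (v ∷ vs) = begin
    length (preimage v ++ pullShots vs)     ≡⟨ length-++ (preimage v) ⟩
    length (preimage v) + length (pullShots vs)
      ≤⟨ +-mono-≤ (⊔-map-upperBound (fibreSize G G' f) (∈-allFin v)) (length-pullShots vs) ⟩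
    k + k * length vs                       ≡⟨ sym (*-suc k (length vs)) ⟩
    k * suc (length vs)                     ∎
    where open ≤-Reasoning

  width-pullStrategy : ∀ Hs → width {G} (pullStrategy Hs) ≤ k * width {G'} Hs
  width-pullStrategy []       = ≤-reflexive (sym (*-zeroʳ k))
  width-pullStrategy (H ∷ Hs) = begin
    length (pullShots H) ⊔ width {G} (pullStrategy Hs)
      ≤⟨ ⊔-mono-≤ (length-pullShots H) (width-pullStrategy Hs) ⟩
    k * length H ⊔ k * width {G'} Hs    ≡⟨ sym (*-distribˡ-⊔ k (length H) (width {G'} Hs)) ⟩
    k * (length H ⊔ width {G'} Hs)      ∎
    where open ≤-Reasoning

  winsFrom-pullStrategy : (R : VSet G) (R' : VSet G') → (∀ u → R u → R' (f u)) →
                          ∀ Hs → WinsFrom G' R' Hs → WinsFrom G R (pullStrategy Hs)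
  winsFrom-pullStrategy R R' R⊆f⁻¹R' []       R'-empty        u Ru = R'-empty (f u) (R⊆f⁻¹R' u Ru)
  winsFrom-pullStrategy R R' R⊆f⁻¹R' (H ∷ Hs) (inj₁ R'-empty) = inj₁ λ u Ru → R'-empty (f u) (R⊆f⁻¹R' u Ru)
  winsFrom-pullStrategy R R' R⊆f⁻¹R' (H ∷ Hs) (inj₂ wins) =
    inj₂ (winsFrom-pullStrategy (step G R (pullShots H)) (step G' R' H) step-⊆ Hs wins)
    where
    step-⊆ : ∀ v → step G R (pullShots H) v → step G' R' H (f v)
    step-⊆ v (u , Ru , u∉ , u~v) = f u , R⊆f⁻¹R' u Ru , (λ fu∈H → u∉ (∈-pullShots u H fu∈H)) , proj₂ φ u~v

  Hun≤maxFibre*Hun : (h h' : ℕ) → IsHun G h → IsHun G' h' → h ≤ k * h'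
  Hun≤maxFibre*Hun h h' (_ , h-minimal) ((Hs , wins , refl) , _) = ≤-trans
    (h-minimal (pullStrategy Hs) (winsFrom-pullStrategy (allV G) (allV G') _ Hs wins))
    (width-pullStrategy Hs)

maxFibre-injective≤1 : (G G' : Graph) (f : V G → V G') → Injective _≡_ _≡_ f →
                       maxFibre G G' f ≤ 1
maxFibre-injective≤1 G G' f f-inj = ⊔-map-lub (fibreSize G G' f) (allFin (n G')) λ v →
  length-filter-unique≤1 (λ u → f u ≟ v) (λ fx≡v fy≡v → f-inj (trans fx≡v (sym fy≡v))) (allFin⁺ (n G))

proposition2p5 :
    ((G G' : Graph) (φ : Hom G G') (h h' : ℕ) → IsHun G h → IsHun G' h' →
      h ≤ maxFibre G G' (proj₁ φ) * h')
    × ((H G : Graph) → Subgraph H G → (h hG : ℕ) → IsHun H h → IsHun G hG →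
      h ≤ hG)
proposition2p5 = (λ G G' φ → Pullback.Hun≤maxFibre*Hun G G' φ) , subgraph
  where
  subgraph : (H G : Graph) → Subgraph H G → (h hG : ℕ) → IsHun H h → IsHun G hG → h ≤ hG
  subgraph H G (φ , φ-inj) h hG hunH hunG = begin
    h                          ≤⟨ Pullback.Hun≤maxFibre*Hun H G φ h hG hunH hunG ⟩
    maxFibre H G (proj₁ φ) * hG ≤⟨ *-monoˡ-≤ hG (maxFibre-injective≤1 H G (proj₁ φ) φ-inj) ⟩
    1 * hG                     ≡⟨ *-identityˡ hG ⟩
    hG                         ∎
    where open ≤-Reasoning
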